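{- For any integer $a\ge 2$ and any positive integer $k$, $$k(a-1)<r_k(F(a,2))\le k(a-1)+3.$$
   Context: For positive integers $a,b$, $F(a,b)$ denotes the $3$-uniform hypergraph with vertex set $A\cup B$, $A\cap B=\emptyset$, $|A|=a$, $|B|=b$, whose edges are all triples containing one vertex of $A$ and two vertices of $B$. For a $3$-uniform hypergraph $H$, $r_k(H)$ is the minimum $n$ such that every coloring of the triples of an $n$-element set with $k$ colors contains a monochromatic copy of $H$. -}

module Defs where

open import Data.Nat using (ℕ; zero; suc; _+_; _<_)
open import Data.Bool using (true; false; if_then_else_)
open import Data.Fin using (Fin; _↑ˡ_; _↑ʳ_) renaming (zero to fzero; suc to fsuc)
open import Data.Fin.Subset using (Subset; ⁅_⁆; _∪_; ⊥)
open import Data.Vec using ([]; _∷_)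
open import Data.Product using (Σ; _×_; ∃)
open import Function.Definitions using (Injective)
open import Relation.Binary.PropositionalEquality using (_≡_; _≢_)
open import Relation.Nullary using (¬_)

-- A 3-uniform hypergraph on vertex set Fin V: a predicate on subsets
-- (its edges, all of which are 3-element subsets).
record Hypergraph3 : Set₁ where
  field
    V    : ℕ
    Edge : Subset V → Set
open Hypergraph3 public

-- F(a,b): vertex set A ∪ B with A = first a vertices, B = last b vertices of Fin (a + b);
-- edges are all triples {x, y, z} with x ∈ A, y, z ∈ B, y ≠ z.
F : ℕ → ℕ → Hypergraph3
F a b = record
  { V    = a + b
  ; Edge = λ e → Σ (Fin a) λ i → Σ (Fin b) λ j → Σ (Fin b) λ l →
             (j ≢ l) × (e ≡ (⁅ i ↑ˡ b ⁆ ∪ (⁅ a ↑ʳ j ⁆ ∪ ⁅ a ↑ʳ l ⁆)))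
  }

image : ∀ {m n} → (Fin m → Fin n) → Subset m → Subset n
image {zero}  φ []      = ⊥
image {suc m} φ (b ∷ e) = (if b then ⁅ φ fzero ⁆ else ⊥) ∪ image (λ x → φ (fsuc x)) e

-- A k-colouring of the triples of an n-set. (Colours are given on all subsets of Fin n,
-- only the values on 3-element subsets are ever used.)
Colouring : ℕ → ℕ → Set
Colouring n k = Subset n → Fin k

MonoCopy : ∀ {n k} → Colouring n k → Hypergraph3 → Set
MonoCopy {n} {k} χ H =
  Σ (Fin (V H) → Fin n) λ φ → Injective _≡_ _≡_ φ ×
    Σ (Fin k) λ c → ∀ e → Edge H e → χ (image φ e) ≡ c

Arrows : ℕ → ℕ → Hypergraph3 → Set
Arrows n k H = ∀ (χ : Colouring n k) → MonoCopy χ H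

IsRamseyNumber : ℕ → Hypergraph3 → ℕ → Set
IsRamseyNumber k H r = Arrows r k H × (∀ m → m < r → ¬ Arrows m k H)

-- F(a,2) is a "star": a triples {x_i, y, z} sharing the pair {y, z}.  Write b = a - 1.
--
-- * Upper bound.  On 3 + kb vertices fix the pair {0, 1} and colour every other
--   vertex t by the colour of {t, 0, 1}.  By the generalised pigeonhole principle
--   some colour class has b + 1 = a vertices; with 0 and 1 they span a
--   monochromatic F(a,2).
-- * Lower bound.  For 0 < m ≤ kb colour a triple of Fin m by the quotient by b of
--   the sum of its labels modulo m (a value below kb).  In a monochromatic star the
--   centres x_i give residues (x_i + y + z) mod m in one block of length b, so two
--   centres give the same residue; translation modulo m is injective, so those two
--   centres coincide.
-- * Exact value.  "n → (F(a,2))_k" is decidable (all colourings and all vertex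
--   maps range over finite sets), so scanning n = kb + 1, kb + 2, kb + 3 finds the
--   least such n, which is r_k(F(a,2)).
module Submission where

open import Defs
open import Algebra.Bundles using (CommutativeMonoid)
open import Data.Bool using (Bool; true; false; if_then_else_; _∨_)
open import Data.Empty using (⊥-elim)
open import Data.Fin using (Fin; zero; suc; toℕ; fromℕ<; inject≤; _↑ˡ_; _↑ʳ_; splitAt; join; quotient; remainder; combine)
open import Data.Fin.Patterns using (0F; 1F)
open import Data.Fin.Properties using (_≟_; any?; all?; pigeonhole; suc-injective; ↑ˡ-injective; ↑ʳ-injective; splitAt-↑ˡ; splitAt-↑ʳ; join-splitAt; combine-remQuot; toℕ-injective; toℕ-inject≤; toℕ-fromℕ<; toℕ<n; ¬Fin0)
  renaming (<-irrefl to <ᶠ-irrefl)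
open import Data.Fin.Subset using (Subset; inside; outside; ⁅_⁆; _∪_; ⊥; _∉_)
open import Data.Fin.Subset.Properties using (∪-comm; ∪-idem; ∪-identityˡ; ∪-identityʳ; ∪-commutativeMonoid; x∈p∪q⁻; x∈⁅y⁆⇒x≡y; drop-not-there)
open import Data.Nat using (ℕ; zero; suc; _+_; _*_; _∸_; _≤_; _<_; _≤?_; z≤n; s≤s)
open import Data.Nat.DivMod using (_%_; _mod_; %-distribˡ-+; [m+kn]%n≡m%n; m<n⇒m%n≡m)
open import Data.Nat.Properties using (+-0-commutativeMonoid; +-suc; +-identityʳ; ≤-refl; ≤-pred; <⇒≤; <⇒≱; ≮⇒≥; m≤n+m; +-mono-≤; m≤n⇒m<n∨m≡n; n<1+n; +-comm)
open import Data.Nat.Tactic.RingSolver using (solve-∀)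
open import Data.Product using (Σ; ∃; _×_; _,_; proj₁)
open import Data.Sum using (_⊎_; inj₁; inj₂; [_,_]′)
open import Data.Vec using ([]; _∷_; here)
open import Data.Vec.Functional as Vector using (head; tail)
open import Function using (_∘_; _∋_)
open import Function.Definitions using (Injective)
open import Relation.Binary.PropositionalEquality
open import Relation.Nullary using (Dec; yes; no; ¬_; does)
open import Relation.Nullary.Decidable using (map′; _×-dec_; _→-dec_)
open import Relation.Unary using (Decidable)

open import Algebra.Properties.CommutativeMonoid.Sum +-0-commutativeMonoid using (∑-comm; sum-cong-≗; sum-replicate-zero; sum-syntax)
import Algebra.Properties.CommutativeSemigroup as CommutativeSemigroupProperties

Extensional : {A B : Set} → ((A → B) → Set) → Set
Extensional {A} {B} P = ∀ {f g : A → B} → (∀ x → f x ≡ g x) → P f → P g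

glue : ∀ {n} {B : Set} → (Subset n → B) → (Subset n → B) → Subset (suc n) → B
glue f g (inside ∷ s)  = f s
glue f g (outside ∷ s) = g s

glue-split : ∀ {n} {B : Set} (f : Subset (suc n) → B) →
  ∀ s → glue (f ∘ (inside ∷_)) (f ∘ (outside ∷_)) s ≡ f s
glue-split f (inside ∷ s)  = refl
glue-split f (outside ∷ s) = refl

all-subset-maps? : ∀ n {k} (P : (Subset n → Fin k) → Set) → Extensional P → Decidable P →
  Dec (∀ f → P f)
all-subset-maps? zero P ext P? =
  map′ (λ h f → ext (λ { [] → refl }) (h (f [])))
       (λ h c → h (λ _ → c))
       (all? (λ c → P? (λ _ → c)))
all-subset-maps? (suc n) P ext P? =
  map′ (λ h f → ext (glue-split f) (h _ _))
       (λ h f g → h (glue f g))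
       (all-subset-maps? n (λ f → ∀ g → P (glue f g))
         (λ f≗f′ h g → ext (λ { (inside ∷ s) → f≗f′ s ; (outside ∷ s) → refl }) (h g))
         (λ f → all-subset-maps? n (λ g → P (glue f g))
           (λ g≗g′ → ext (λ { (inside ∷ s) → refl ; (outside ∷ s) → g≗g′ s }))
           (λ g → P? (glue f g))))

any-map? : ∀ n {m} (P : (Fin n → Fin m) → Set) → Extensional P → Decidable P → Dec (∃ P)
any-map? zero P ext P? = map′ (λ p → empty , p) (λ (f , p) → ext (λ ()) p) (P? empty)
  where
  empty : Fin zero → _
  empty ()
any-map? (suc n) P ext P? =
  map′ (λ (x , g , p) → x Vector.∷ g , p)
       (λ (f , p) → head f , tail f , ext (λ { zero → refl ; (suc i) → refl }) p)
       (any? (λ x → any-map? n (λ g → P (x Vector.∷ g))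
         (λ g≗g′ → ext (λ { zero → refl ; (suc i) → g≗g′ i }))
         (λ g → P? (x Vector.∷ g))))

injective? : ∀ {n m} (φ : Fin n → Fin m) → Dec (Injective _≡_ _≡_ φ)
injective? φ = map′ (λ h {x} {y} → h x y) (λ h x y → h)
  (all? λ x → all? λ y → (φ x ≟ φ y) →-dec (x ≟ y))

fails-below-suc : {P : ℕ → Set} {i : ℕ} → (∀ m → m < i → ¬ P m) → ¬ P i → ∀ m → m < suc i → ¬ P m
fails-below-suc below ¬Pi m (s≤s m≤i) with m≤n⇒m<n∨m≡n m≤i
... | inj₁ m<i  = below m m<i
... | inj₂ refl = ¬Pi

least-witness-in-window : {P : ℕ → Set} → Decidable P → ∀ d i → (∀ m → m < i → ¬ P m) → P (d + i) →
  Σ ℕ λ r → (P r × (∀ m → m < r → ¬ P m)) × i ≤ r × r ≤ d + i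
least-witness-in-window P? d i below P[d+i] with P? i
... | yes Pi = i , (Pi , below) , ≤-refl , m≤n+m i d
least-witness-in-window P? zero i below Pi | no ¬Pi = ⊥-elim (¬Pi Pi)
least-witness-in-window {P} P? (suc d) i below P[d+i] | no ¬Pi
  with r , least , i<r , r≤ ← least-witness-in-window P? d (suc i) (fails-below-suc below ¬Pi) (subst P (sym (+-suc d i)) P[d+i])
  = r , least , <⇒≤ i<r , subst (r ≤_) (+-suc d i) r≤

indicator : Bool → ℕ
indicator b = if b then 1 else 0

count : ∀ {n} {P : Fin n → Set} → Decidable P → ℕ
count {n} P? = ∑[ x < n ] indicator (does (P? x))

select : ∀ {n} {P : Fin n → Set} (P? : Decidable P) a → a ≤ count P? →
  Σ (Fin a → Fin n) λ g → Injective _≡_ _≡_ g × (∀ i → P (g i))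
select P? zero _ = (λ ()) , (λ { {()} }) , (λ ())
select {suc n} P? (suc a) a≤ with P? zero
... | yes P0 with g , g-inj , g-sat ← select (P? ∘ suc) a (≤-pred a≤)
  = zero Vector.∷ (suc ∘ g) , extended-injective _ _ , λ { zero → P0 ; (suc i) → g-sat i }
  where
  extended-injective : ∀ x y → (zero Vector.∷ (suc ∘ g)) x ≡ (zero Vector.∷ (suc ∘ g)) y → x ≡ y
  extended-injective zero    zero    _  = refl
  extended-injective (suc x) (suc y) eq = cong suc (g-inj (suc-injective eq))
  extended-injective zero    (suc y) ()
  extended-injective (suc x) zero    ()
... | no _ with g , g-inj , g-sat ← select (P? ∘ suc) (suc a) a≤
  = suc ∘ g , g-inj ∘ suc-injective , g-sat

matches-exactly-once : ∀ {k} (d : Fin k) → ∑[ c < k ] indicator (does (d ≟ c)) ≡ 1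
matches-exactly-once {suc k} zero    = cong suc (sum-replicate-zero k)
matches-exactly-once {suc k} (suc d) = matches-exactly-once d

∑-ones : ∀ n → ∑[ x < n ] 1 ≡ n
∑-ones zero    = refl
∑-ones (suc n) = cong suc (∑-ones n)

class-sizes : ∀ {n k} (f : Fin n → Fin k) → ∑[ c < k ] count (λ x → f x ≟ c) ≡ n
class-sizes {n} {k} f = begin
  ∑[ c < k ] ∑[ x < n ] indicator (does (f x ≟ c)) ≡⟨ ∑-comm (λ x c → indicator (does (f x ≟ c))) ⟨
  ∑[ x < n ] ∑[ c < k ] indicator (does (f x ≟ c)) ≡⟨ sum-cong-≗ (matches-exactly-once ∘ f) ⟩
  ∑[ x < n ] 1                                     ≡⟨ ∑-ones n ⟩
  n                                                ∎
  where open ≡-Reasoning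

∑-bound : ∀ {k} b (h : Fin k → ℕ) → (∀ c → h c ≤ b) → ∑[ c < k ] h c ≤ k * b
∑-bound {zero}  b h h≤b = z≤n
∑-bound {suc k} b h h≤b = +-mono-≤ (h≤b zero) (∑-bound b (h ∘ suc) (h≤b ∘ suc))

pigeonhole-classes : ∀ {n k b} → k * b < n → (f : Fin n → Fin k) →
  Σ (Fin k) λ c → Σ (Fin (suc b) → Fin n) λ g → Injective _≡_ _≡_ g × (∀ i → f (g i) ≡ c)
pigeonhole-classes {n} {k} {b} kb<n f with any? (λ c → suc b ≤? count (λ x → f x ≟ c))
... | yes (c , large) = c , select (λ x → f x ≟ c) (suc b) large
... | no ¬large = ⊥-elim (<⇒≱ kb<n (subst (_≤ k * b) (class-sizes f)
                    (∑-bound b _ (λ c → ≮⇒≥ (λ large → ¬large (c , large))))))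

↑ˡ≢↑ʳ : ∀ {m n} (i : Fin m) (j : Fin n) → i ↑ˡ n ≢ m ↑ʳ j
↑ˡ≢↑ʳ {m} {n} i j eq = inj₁≢inj₂ (begin
  inj₁ i               ≡⟨ splitAt-↑ˡ m i n ⟨
  splitAt m (i ↑ˡ n)   ≡⟨ cong (splitAt m) eq ⟩
  splitAt m (m ↑ʳ j)   ≡⟨ splitAt-↑ʳ m n j ⟩
  inj₂ j               ∎)
  where
  open ≡-Reasoning
  inj₁≢inj₂ : (Fin m ⊎ Fin n ∋ inj₁ i) ≢ inj₂ j
  inj₁≢inj₂ ()

glued-injective : ∀ {m n p} (f : Fin m → Fin p) (g : Fin n → Fin p) →
  Injective _≡_ _≡_ f → Injective _≡_ _≡_ g → (∀ i j → f i ≢ g j) →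
  Injective _≡_ _≡_ (λ x → [ f , g ]′ (splitAt m x))
glued-injective {m} {n} f g f-inj g-inj disjoint {x} {y} eq = begin
  x                        ≡⟨ join-splitAt m n x ⟨
  join m n (splitAt m x)   ≡⟨ cong (join m n) (halves (splitAt m x) (splitAt m y) eq) ⟩
  join m n (splitAt m y)   ≡⟨ join-splitAt m n y ⟩
  y                        ∎
  where
  open ≡-Reasoning
  halves : ∀ u v → [ f , g ]′ u ≡ [ f , g ]′ v → u ≡ v
  halves (inj₁ i) (inj₁ j) e = cong inj₁ (f-inj e)
  halves (inj₁ i) (inj₂ j) e = ⊥-elim (disjoint i j e)
  halves (inj₂ i) (inj₁ j) e = ⊥-elim (disjoint j i (sym e))
  halves (inj₂ i) (inj₂ j) e = cong inj₂ (g-inj e)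

when : ∀ {n} → Bool → Subset n → Subset n
when b S = if b then S else ⊥

when-∨ : ∀ {n} a b (S : Subset n) → when (a ∨ b) S ≡ when a S ∪ when b S
when-∨ true  true  S = sym (∪-idem S)
when-∨ true  false S = sym (∪-identityʳ S)
when-∨ false b     S = sym (∪-identityˡ _)

image-⊥ : ∀ {m n} (φ : Fin m → Fin n) → image φ ⊥ ≡ ⊥
image-⊥ {zero}  φ = refl
image-⊥ {suc m} φ = trans (∪-identityˡ _) (image-⊥ (φ ∘ suc))

image-∪ : ∀ {m n} (φ : Fin m → Fin n) A B → image φ (A ∪ B) ≡ image φ A ∪ image φ B
image-∪ {zero}      φ [] [] = sym (∪-idem ⊥)
image-∪ {suc m} {n} φ (a ∷ A) (b ∷ B) = begin
  when (a ∨ b) x ∪ image (φ ∘ suc) (A ∪ B)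
    ≡⟨ cong₂ _∪_ (when-∨ a b x) (image-∪ (φ ∘ suc) A B) ⟩
  (when a x ∪ when b x) ∪ (image (φ ∘ suc) A ∪ image (φ ∘ suc) B)
    ≡⟨ interchange _ _ _ _ ⟩
  (when a x ∪ image (φ ∘ suc) A) ∪ (when b x ∪ image (φ ∘ suc) B) ∎
  where
  open ≡-Reasoning
  open CommutativeSemigroupProperties (CommutativeMonoid.commutativeSemigroup (∪-commutativeMonoid n)) using (interchange)
  x = ⁅ φ zero ⁆

image-⁅⁆ : ∀ {m n} (φ : Fin m → Fin n) x → image φ ⁅ x ⁆ ≡ ⁅ φ x ⁆
image-⁅⁆ {suc m} φ zero    = trans (cong (⁅ φ zero ⁆ ∪_) (image-⊥ (φ ∘ suc))) (∪-identityʳ _)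
image-⁅⁆ {suc m} φ (suc x) = trans (∪-identityˡ _) (image-⁅⁆ (φ ∘ suc) x)

image-triple : ∀ {m n} (φ : Fin m → Fin n) x y z →
  image φ (⁅ x ⁆ ∪ (⁅ y ⁆ ∪ ⁅ z ⁆)) ≡ ⁅ φ x ⁆ ∪ (⁅ φ y ⁆ ∪ ⁅ φ z ⁆)
image-triple φ x y z = begin
  image φ (⁅ x ⁆ ∪ (⁅ y ⁆ ∪ ⁅ z ⁆))                ≡⟨ image-∪ φ _ _ ⟩
  image φ ⁅ x ⁆ ∪ image φ (⁅ y ⁆ ∪ ⁅ z ⁆)          ≡⟨ cong (image φ ⁅ x ⁆ ∪_) (image-∪ φ _ _) ⟩
  image φ ⁅ x ⁆ ∪ (image φ ⁅ y ⁆ ∪ image φ ⁅ z ⁆)  ≡⟨ cong₂ _∪_ (image-⁅⁆ φ x) (cong₂ _∪_ (image-⁅⁆ φ y) (image-⁅⁆ φ z)) ⟩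
  ⁅ φ x ⁆ ∪ (⁅ φ y ⁆ ∪ ⁅ φ z ⁆)                    ∎
  where open ≡-Reasoning

-- In F(a,2) the i-th centre is i ↑ˡ 2 and the two apexes are a ↑ʳ 0F and a ↑ʳ 1F;
-- starEdge φ i is the image under φ of the edge through the i-th centre.
starEdge : ∀ {a m} → (Fin (a + 2) → Fin m) → Fin a → Subset m
starEdge {a} φ i = ⁅ φ (i ↑ˡ 2) ⁆ ∪ (⁅ φ (a ↑ʳ 0F) ⁆ ∪ ⁅ φ (a ↑ʳ 1F) ⁆)

starEdge-cong : ∀ {a m} {φ ψ : Fin (a + 2) → Fin m} → (∀ x → φ x ≡ ψ x) →
  ∀ i → starEdge φ i ≡ starEdge ψ i
starEdge-cong φ≗ψ i = cong₂ _∪_ (cong ⁅_⁆ (φ≗ψ _)) (cong₂ _∪_ (cong ⁅_⁆ (φ≗ψ _)) (cong ⁅_⁆ (φ≗ψ _)))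

IsMonoStar : ∀ {m k} a → Colouring m k → (Fin (a + 2) → Fin m) → Set
IsMonoStar {k = k} a χ φ = Injective _≡_ _≡_ φ × Σ (Fin k) λ c → ∀ i → χ (starEdge φ i) ≡ c

MonoStar : ∀ {m k} a → Colouring m k → Set
MonoStar a χ = ∃ (IsMonoStar a χ)

copy⇒star : ∀ {m k} a (χ : Colouring m k) → MonoCopy χ (F a 2) → MonoStar a χ
copy⇒star a χ (φ , φ-inj , c , mono) = φ , φ-inj , c , λ i →
  trans (cong χ (sym (image-triple φ _ _ _))) (mono _ (i , 0F , 1F , (λ ()) , refl))

star⇒copy : ∀ {m k} a (χ : Colouring m k) → MonoStar a χ → MonoCopy χ (F a 2)
star⇒copy a χ (φ , φ-inj , c , mono) = φ , φ-inj , c , edge-colour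
  where
  edge-colour : ∀ e → Edge (F a 2) e → χ (image φ e) ≡ c
  edge-colour e (i , 0F , 0F , 0≢0 , _)    = ⊥-elim (0≢0 refl)
  edge-colour e (i , 1F , 1F , 1≢1 , _)    = ⊥-elim (1≢1 refl)
  edge-colour e (i , 0F , 1F , _ , refl) = trans (cong χ (image-triple φ _ _ _)) (mono i)
  edge-colour e (i , 1F , 0F , _ , refl) =
    trans (cong χ (trans (image-triple φ _ _ _) (cong (⁅ φ (i ↑ˡ 2) ⁆ ∪_) (∪-comm _ _)))) (mono i)

monoStar? : ∀ {m k} a (χ : Colouring m k) → Dec (MonoStar a χ)
monoStar? a χ = any-map? (a + 2) (IsMonoStar a χ) respects-pointwise
  (λ φ → injective? φ ×-dec any? (λ c → all? (λ i → χ (starEdge φ i) ≟ c)))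
  where
  respects-pointwise : Extensional (IsMonoStar a χ)
  respects-pointwise φ≗ψ (φ-inj , c , mono) =
    (λ {x} {y} e → φ-inj (trans (φ≗ψ x) (trans e (sym (φ≗ψ y))))) , c ,
    λ i → trans (cong χ (sym (starEdge-cong φ≗ψ i))) (mono i)

arrows? : ∀ k a m → Dec (Arrows m k (F a 2))
arrows? k a m = map′ (λ h χ → star⇒copy a χ (h χ)) (λ h χ → copy⇒star a χ (h χ))
  (all-subset-maps? m (MonoStar a)
    (λ χ≗χ′ (φ , φ-inj , c , mono) → φ , φ-inj , c , λ i → trans (sym (χ≗χ′ _)) (mono i))
    (monoStar? a))

-- Upper bound: 3 + kb → (F(b+1,2))_k.  Vertices 0 and 1 are the apexes; every other
-- vertex 2 ↑ʳ t gets the colour of its triple with them, and b + 1 vertices of one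
-- colour are the centres.
arrows-above : ∀ k b → Arrows (3 + k * b) k (F (suc b) 2)
arrows-above k b χ = star-on-class (pigeonhole-classes (n<1+n (k * b)) link)
  where
  link : Fin (suc (k * b)) → Fin k
  link t = χ (⁅ 2 ↑ʳ t ⁆ ∪ (⁅ 0F ⁆ ∪ ⁅ 1F ⁆))

  apex : Fin 2 → Fin (3 + k * b)
  apex j = j ↑ˡ suc (k * b)

  star-on-class : (Σ (Fin k) λ c → Σ (Fin (suc b) → Fin (suc (k * b))) λ centre →
                    Injective _≡_ _≡_ centre × (∀ i → link (centre i) ≡ c)) →
                  MonoCopy χ (F (suc b) 2)
  star-on-class (c , centre , centre-inj , same-colour) = star⇒copy (suc b) χ (φ , φ-inj , c , mono)
    where
    φ : Fin (suc b + 2) → Fin (3 + k * b)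
    φ x = [ (λ i → 2 ↑ʳ centre i) , apex ]′ (splitAt (suc b) x)

    φ-inj : Injective _≡_ _≡_ φ
    φ-inj = glued-injective _ apex (centre-inj ∘ ↑ʳ-injective 2 _ _) (↑ˡ-injective _ _ _)
      (λ i j e → ↑ˡ≢↑ʳ j (centre i) (sym e))

    mono : ∀ i → χ (starEdge φ i) ≡ c
    mono i rewrite splitAt-↑ˡ (suc b) i 2 | splitAt-↑ʳ (suc b) 2 0F | splitAt-↑ʳ (suc b) 2 1F = same-colour i

labelSumFrom : ∀ {n} → ℕ → Subset n → ℕ
labelSumFrom o []      = 0
labelSumFrom o (b ∷ s) = (if b then o else 0) + labelSumFrom (suc o) s

labelSumFrom-⊥ : ∀ {n} o → labelSumFrom {n} o ⊥ ≡ 0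
labelSumFrom-⊥ {zero}  o = refl
labelSumFrom-⊥ {suc n} o = labelSumFrom-⊥ {n} (suc o)

labelSumFrom-⁅⁆ : ∀ {n} o (x : Fin n) → labelSumFrom o ⁅ x ⁆ ≡ o + toℕ x
labelSumFrom-⁅⁆ {suc n} o zero    = cong (o +_) (labelSumFrom-⊥ {n} (suc o))
labelSumFrom-⁅⁆ {suc n} o (suc x) = trans (labelSumFrom-⁅⁆ (suc o) x) (sym (+-suc o (toℕ x)))

labelSumFrom-insert : ∀ {n} o (x : Fin n) B → x ∉ B →
  labelSumFrom o (⁅ x ⁆ ∪ B) ≡ (o + toℕ x) + labelSumFrom o B
labelSumFrom-insert o zero    (inside ∷ B)  x∉B = ⊥-elim (x∉B here)
labelSumFrom-insert o zero    (outside ∷ B) _ rewrite ∪-identityˡ B | +-identityʳ o = refl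
labelSumFrom-insert o (suc x) (b ∷ B)       x∉B
  rewrite labelSumFrom-insert (suc o) x B (drop-not-there x∉B) =
  rearrange (if b then o else 0) o (toℕ x) (labelSumFrom (suc o) B)
  where
  rearrange : ∀ p o t q → p + ((suc o + t) + q) ≡ (o + suc t) + (p + q)
  rearrange = solve-∀

labelSum : ∀ {n} → Subset n → ℕ
labelSum = labelSumFrom 0

labelSum-triple : ∀ {n} (x y z : Fin n) → x ≢ y → x ≢ z → y ≢ z →
  labelSum (⁅ x ⁆ ∪ (⁅ y ⁆ ∪ ⁅ z ⁆)) ≡ toℕ x + (toℕ y + toℕ z)
labelSum-triple x y z x≢y x≢z y≢z = begin
  labelSum (⁅ x ⁆ ∪ (⁅ y ⁆ ∪ ⁅ z ⁆))     ≡⟨ labelSumFrom-insert 0 x _ x∉yz ⟩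
  toℕ x + labelSum (⁅ y ⁆ ∪ ⁅ z ⁆)      ≡⟨ cong (toℕ x +_) (labelSumFrom-insert 0 y _ (y≢z ∘ x∈⁅y⁆⇒x≡y z)) ⟩
  toℕ x + (toℕ y + labelSum ⁅ z ⁆)      ≡⟨ cong (λ s → toℕ x + (toℕ y + s)) (labelSumFrom-⁅⁆ 0 z) ⟩
  toℕ x + (toℕ y + toℕ z)               ∎
  where
  open ≡-Reasoning
  x∉yz : x ∉ ⁅ y ⁆ ∪ ⁅ z ⁆
  x∉yz x∈yz with x∈p∪q⁻ ⁅ y ⁆ ⁅ z ⁆ x∈yz
  ... | inj₁ x∈y = x≢y (x∈⁅y⁆⇒x≡y y x∈y)
  ... | inj₂ x∈z = x≢z (x∈⁅y⁆⇒x≡y z x∈z)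

%-shift-cancel : ∀ m x y S → (x + S) % suc m ≡ (y + S) % suc m → x % suc m ≡ y % suc m
%-shift-cancel m x y S eq = begin
  x % suc m                                          ≡⟨ through x ⟩
  ((x + S) % suc m + (S * m) % suc m) % suc m        ≡⟨ cong (λ r → (r + (S * m) % suc m) % suc m) eq ⟩
  ((y + S) % suc m + (S * m) % suc m) % suc m        ≡⟨ through y ⟨
  y % suc m                                          ∎
  where
  open ≡-Reasoning
  regroup : ∀ x S m → x + S * suc m ≡ (x + S) + S * m
  regroup = solve-∀
  -- x ≡ x + S(m + 1) ≡ (x + S) + Sm  modulo m + 1
  through : ∀ x → x % suc m ≡ ((x + S) % suc m + (S * m) % suc m) % suc m
  through x = begin
    x % suc m                                      ≡⟨ [m+kn]%n≡m%n x S (suc m) ⟨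
    (x + S * suc m) % suc m                        ≡⟨ cong (_% suc m) (regroup x S m) ⟩
    ((x + S) + S * m) % suc m                      ≡⟨ %-distribˡ-+ (x + S) (S * m) (suc m) ⟩
    ((x + S) % suc m + (S * m) % suc m) % suc m    ∎

quotient-remainder-injective : ∀ {k} b (u v : Fin (k * b)) →
  quotient {k} b u ≡ quotient {k} b v → remainder {k} b u ≡ remainder {k} b v → u ≡ v
quotient-remainder-injective {k} b u v same-quotient same-remainder = begin
  u                                              ≡⟨ combine-remQuot {k} b u ⟨
  combine (quotient {k} b u) (remainder {k} b u) ≡⟨ cong₂ combine same-quotient same-remainder ⟩
  combine (quotient {k} b v) (remainder {k} b v) ≡⟨ combine-remQuot {k} b v ⟩
  v                                              ∎
  where open ≡-Reasoning

module BlockColouring {k b m : ℕ} (m<kb : suc m ≤ k * b) where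

  residue : Subset (suc m) → Fin (k * b)
  residue e = inject≤ (labelSum e mod suc m) m<kb

  toℕ-residue : ∀ e → toℕ (residue e) ≡ labelSum e % suc m
  toℕ-residue e = trans (toℕ-inject≤ _ m<kb) (toℕ-fromℕ< _)

  colouring : Colouring (suc m) k
  colouring e = quotient {k} b (residue e)

  -- No monochromatic F(b+1,2): two of the b + 1 centres would have residues with
  -- equal remainder and quotient, hence equal residues, hence they coincide.
  no-mono-star : ¬ MonoStar (suc b) colouring
  no-mono-star (φ , φ-inj , c , mono)
    with i , j , i<j , same-remainder ← pigeonhole (n<1+n b) (remainder {k} b ∘ residue ∘ starEdge φ)
    = <ᶠ-irrefl (↑ˡ-injective 2 i j (φ-inj (toℕ-injective centres-agree))) i<j
    where
    open ≡-Reasoning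
    centre : Fin (suc b) → Fin (suc m)
    centre i = φ (i ↑ˡ 2)

    S : ℕ
    S = toℕ (φ (suc b ↑ʳ 0F)) + toℕ (φ (suc b ↑ʳ 1F))

    toℕ-edge-residue : ∀ i → toℕ (residue (starEdge φ i)) ≡ (toℕ (centre i) + S) % suc m
    toℕ-edge-residue i = trans (toℕ-residue (starEdge φ i)) (cong (_% suc m) (labelSum-triple _ _ _
      (↑ˡ≢↑ʳ i 0F ∘ φ-inj) (↑ˡ≢↑ʳ i 1F ∘ φ-inj) (λ e → 0≢1 (↑ʳ-injective (suc b) 0F 1F (φ-inj e)))))
      where
      0≢1 : 0F ≢ 1F
      0≢1 ()

    same-residue : residue (starEdge φ i) ≡ residue (starEdge φ j)
    same-residue = quotient-remainder-injective {k} b _ _ (trans (mono i) (sym (mono j))) same-remainder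

    shifted-centres-agree : (toℕ (centre i) + S) % suc m ≡ (toℕ (centre j) + S) % suc m
    shifted-centres-agree = begin
      (toℕ (centre i) + S) % suc m   ≡⟨ toℕ-edge-residue i ⟨
      toℕ (residue (starEdge φ i))   ≡⟨ cong toℕ same-residue ⟩
      toℕ (residue (starEdge φ j))   ≡⟨ toℕ-edge-residue j ⟩
      (toℕ (centre j) + S) % suc m   ∎

    centres-agree : toℕ (centre i) ≡ toℕ (centre j)
    centres-agree = begin
      toℕ (centre i)            ≡⟨ m<n⇒m%n≡m (toℕ<n (centre i)) ⟨
      toℕ (centre i) % suc m    ≡⟨ %-shift-cancel m (toℕ (centre i)) (toℕ (centre j)) S shifted-centres-agree ⟩
      toℕ (centre j) % suc m    ≡⟨ m<n⇒m%n≡m (toℕ<n (centre j)) ⟩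
      toℕ (centre j)            ∎

no-arrows-below : ∀ k b m → m ≤ suc k * b → ¬ Arrows m (suc k) (F (suc b) 2)
no-arrows-below k b zero    _    arrows = ¬Fin0 (proj₁ (arrows (λ _ → zero)) zero)
no-arrows-below k b (suc m) m<kb arrows =
  no-mono-star (copy⇒star (suc b) colouring (arrows colouring))
  where open BlockColouring {suc k} {b} m<kb

mainTheorem7 : ∀ (a k : ℕ) → 2 ≤ a → 1 ≤ k →
    Σ ℕ λ r → IsRamseyNumber k (F a 2) r × (k * (a ∸ 1) < r) × (r ≤ k * (a ∸ 1) + 3)
mainTheorem7 (suc (suc b)) (suc k) (s≤s (s≤s _)) (s≤s _) =
  let N = suc k * suc b
      r , ramsey , N<r , r≤N+3 =
        least-witness-in-window (arrows? (suc k) (suc (suc b))) 2 (suc N)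
          (λ m m<N+1 → no-arrows-below k (suc b) m (≤-pred m<N+1))
          (arrows-above (suc k) (suc b))
  in r , ramsey , N<r , subst (r ≤_) (+-comm 3 N) r≤N+3
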